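{- Let $B$ be a finite set, let $\sigma,\mu\in\mathrm{Sym}(B)$ and let $B'\subseteq B$. Then \[\sigma_{B'}\,\mu_{B'}=(\sigma\,\mu_{B'})_{B'}\qquad\text{and consequently}\qquad \sigma_{|B'}\,\mu_{|B'}=(\sigma\,\mu_{B'})_{|B'}.\]
   Context: Permutations are composed as functions: $\sigma\tau=\sigma\circ\tau$. For $\mu\in\mathrm{Sym}(B)$ and $B'\subseteq B$, the restriction $\mu_{|B'}\in\mathrm{Sym}(B')$ is defined by $\mu_{|B'}(b)=\mu^k(b)$ for $b\in B'$, where $k$ is the least positive integer with $\mu^k(b)\in B'$. The cutting-out $\mu_{B'}\in\mathrm{Sym}(B)$ is the permutation of $B$ equal to $\mu_{|B'}$ on $B'$ and to the identity on $B\setminus B'$. -}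

module Defs where

open import Data.Nat using (ℕ; zero; suc)
open import Data.Fin using (Fin)
open import Data.Fin.Subset using (Subset; _∈_)
open import Data.Fin.Subset.Properties using (_∈?_)
open import Relation.Nullary using (yes; no)

-- B is modelled as Fin n; a permutation is Data.Fin.Permutation.Permutation′ n,
-- but the operations below act on the underlying functions Fin n → Fin n.

iter : ∀ {n} → (Fin n → Fin n) → ℕ → Fin n → Fin n
iter f zero    b = b
iter f (suc k) b = f (iter f k b)

firstHit : ∀ {n} → (Fin n → Fin n) → Subset n → ℕ → Fin n → Fin n
firstHit f S zero    x = x
firstHit f S (suc m) x with f x ∈? S
... | yes _ = f x
... | no  _ = firstHit f S m (f x)

-- Restriction μ_{|B'}: for b ∈ B', μ^k b with k ≥ 1 least such that μ^k b ∈ B'.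
-- For a permutation μ of an n-element set and b ∈ B' such k exists and k ≤ n,
-- so searching the first n iterates computes exactly this value.
-- (Only meaningful for arguments b ∈ B'.)
restr : ∀ {n} → (Fin n → Fin n) → Subset n → Fin n → Fin n
restr {n} μ B' b = firstHit μ B' n b

cut : ∀ {n} → (Fin n → Fin n) → Subset n → Fin n → Fin n
cut μ B' b with b ∈? B'
... | yes _ = restr μ B' b
... | no  _ = b

{-# OPTIONS --safe #-}
-- For b ∈ B', μ_{B'} sends b to μ_{|B'} b and is the identity off B', so the σ μ_{B'}-orbit
-- of b up to its return to B' is the σ-orbit of μ_{|B'} b up to its return to B'.
-- That μ_{|B'} maps B' into itself is the pigeonhole principle: under an injection of a
-- finite set every point returns to itself.
module Submission where

open import Defs
open import Data.Nat using (ℕ; zero; suc; z≤n; s≤s; _≤_; _<_)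
open import Data.Nat.Properties using (≤-refl; ≤-trans; m≤n⇒m≤1+n; ≤-pred; n<1+n)
open import Data.Fin using (Fin; toℕ)
open import Data.Fin.Properties using (pigeonhole; toℕ<n)
open import Data.Fin.Subset using (Subset; _∈_; _∉_)
open import Data.Fin.Subset.Properties using (_∈?_)
open import Data.Fin.Permutation using (Permutation′; _⟨$⟩ʳ_)
open import Data.Product using (_×_; _,_; ∃-syntax)
open import Data.Empty using (⊥-elim)
open import Function using (_∘_)
open import Function.Bundles using (Injection)
open import Function.Definitions using (Injective)
open import Function.Properties.Inverse using (↔⇒↣)
open import Relation.Nullary using (Dec; yes; no)
open import Relation.Binary.PropositionalEquality
  using (_≡_; refl; sym; cong; subst; module ≡-Reasoning)

module _ {n : ℕ} where

  iter-suc : (f : Fin n → Fin n) (k : ℕ) (x : Fin n) → iter f (suc k) x ≡ iter f k (f x)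
  iter-suc f zero    x = refl
  iter-suc f (suc k) x = cong f (iter-suc f k x)

  iter-cancel : {f : Fin n → Fin n} → Injective _≡_ _≡_ f → {x : Fin n} (i j : ℕ) →
                i < j → iter f i x ≡ iter f j x → ∃[ k ] 1 ≤ k × k ≤ j × iter f k x ≡ x
  iter-cancel f-inj zero    j       i<j fⁱx≡fʲx = j , i<j , ≤-refl , sym fⁱx≡fʲx
  iter-cancel f-inj (suc i) (suc j) (s≤s i<j) fⁱx≡fʲx
    with k , 1≤k , k≤j , fᵏx≡x ← iter-cancel f-inj i j i<j (f-inj fⁱx≡fʲx)
    = k , 1≤k , m≤n⇒m≤1+n k≤j , fᵏx≡x

  iter-return : {f : Fin n → Fin n} → Injective _≡_ _≡_ f → (x : Fin n) →
                ∃[ k ] 1 ≤ k × k ≤ n × iter f k x ≡ x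
  iter-return {f} f-inj x
    with i , j , i<j , fⁱx≡fʲx ← pigeonhole (n<1+n n) (λ (i : Fin (suc n)) → iter f (toℕ i) x)
    with k , 1≤k , k≤j , fᵏx≡x ← iter-cancel f-inj (toℕ i) (toℕ j) i<j fⁱx≡fʲx
    = k , 1≤k , ≤-trans k≤j (≤-pred (toℕ<n j)) , fᵏx≡x

  firstHit-∈ : (f : Fin n → Fin n) (S : Subset n) (m k : ℕ) (x : Fin n) →
               1 ≤ k → k ≤ m → iter f k x ∈ S → firstHit f S m x ∈ S
  firstHit-∈ f S zero    (suc k) x _ ()
  firstHit-∈ f S (suc m) k x _ _ _ with f x ∈? S
  ... | yes fx∈S = fx∈S
  firstHit-∈ f S (suc m) 1 x _ _ fx∈S | no fx∉S = ⊥-elim (fx∉S fx∈S)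
  firstHit-∈ f S (suc m) (suc (suc k)) x _ (s≤s k≤m) fᵏx∈S | no _ =
    firstHit-∈ f S m (suc k) (f x) (s≤s z≤n) k≤m (subst (_∈ S) (iter-suc f (suc k) x) fᵏx∈S)

  restr-∈ : {f : Fin n → Fin n} → Injective _≡_ _≡_ f → (S : Subset n) {b : Fin n} →
            b ∈ S → restr f S b ∈ S
  restr-∈ {f} f-inj S {b} b∈S with k , 1≤k , k≤n , fᵏb≡b ← iter-return f-inj b =
    firstHit-∈ f S n k b 1≤k k≤n (subst (_∈ S) (sym fᵏb≡b) b∈S)

  firstHit-cong-∉ : {f g : Fin n → Fin n} (S : Subset n) → (∀ y → y ∉ S → f y ≡ g y) →
                    (m : ℕ) {x : Fin n} → x ∉ S → firstHit f S m x ≡ firstHit g S m x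
  firstHit-cong-∉ S f≗g zero    x∉S = refl
  firstHit-cong-∉ {f} {g} S f≗g (suc m) {x} x∉S with f x ∈? S | g x ∈? S | f≗g x x∉S
  ... | yes _    | yes _    | fx≡gx = fx≡gx
  ... | yes fx∈S | no  gx∉S | fx≡gx = ⊥-elim (gx∉S (subst (_∈ S) fx≡gx fx∈S))
  ... | no  fx∉S | yes gx∈S | fx≡gx = ⊥-elim (fx∉S (subst (_∈ S) (sym fx≡gx) gx∈S))
  ... | no  fx∉S | no  _    | fx≡gx rewrite fx≡gx = firstHit-cong-∉ S f≗g m fx∉S

  firstHit-∘ : (f g : Fin n → Fin n) (S : Subset n) → (∀ y → y ∉ S → g y ≡ y) →
               (m : ℕ) (x : Fin n) → firstHit (f ∘ g) S (suc m) x ≡ firstHit f S (suc m) (g x)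
  firstHit-∘ f g S g-id m x with f (g x) ∈? S
  ... | yes _       = refl
  ... | no  fgx∉S = firstHit-cong-∉ S (λ y y∉S → cong f (g-id y y∉S)) m fgx∉S

  cut-∈ : (μ : Fin n → Fin n) (S : Subset n) {b : Fin n} → b ∈ S → cut μ S b ≡ restr μ S b
  cut-∈ μ S {b} b∈S with b ∈? S
  ... | yes _   = refl
  ... | no  b∉S = ⊥-elim (b∉S b∈S)

  cut-∉ : (μ : Fin n → Fin n) (S : Subset n) {b : Fin n} → b ∉ S → cut μ S b ≡ b
  cut-∉ μ S {b} b∉S with b ∈? S
  ... | yes b∈S = ⊥-elim (b∉S b∈S)
  ... | no  _   = refl

restr-∘-cut : ∀ {n} (σ μ : Fin n → Fin n) (S : Subset n) {b : Fin n} → b ∈ S →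
              restr σ S (restr μ S b) ≡ restr (σ ∘ cut μ S) S b
restr-∘-cut {suc m} σ μ S {b} b∈S = begin
  firstHit σ S (suc m) (restr μ S b)        ≡⟨ cong (firstHit σ S (suc m)) (cut-∈ μ S b∈S) ⟨
  firstHit σ S (suc m) (cut μ S b)          ≡⟨ firstHit-∘ σ (cut μ S) S (λ _ → cut-∉ μ S) m b ⟨
  firstHit (σ ∘ cut μ S) S (suc m) b        ∎
  where open ≡-Reasoning

cut-∘-cut : ∀ {n} (σ : Fin n → Fin n) {μ : Fin n → Fin n} → Injective _≡_ _≡_ μ →
            (S : Subset n) (b : Fin n) → cut σ S (cut μ S b) ≡ cut (σ ∘ cut μ S) S b
cut-∘-cut σ {μ} μ-inj S b = by-membership (b ∈? S)
  where
  open ≡-Reasoning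
  by-membership : Dec (b ∈ S) → cut σ S (cut μ S b) ≡ cut (σ ∘ cut μ S) S b
  by-membership (no b∉S) = begin
    cut σ S (cut μ S b)       ≡⟨ cong (cut σ S) (cut-∉ μ S b∉S) ⟩
    cut σ S b                 ≡⟨ cut-∉ σ S b∉S ⟩
    b                         ≡⟨ cut-∉ (σ ∘ cut μ S) S b∉S ⟨
    cut (σ ∘ cut μ S) S b     ∎
  by-membership (yes b∈S) = begin
    cut σ S (cut μ S b)       ≡⟨ cong (cut σ S) (cut-∈ μ S b∈S) ⟩
    cut σ S (restr μ S b)     ≡⟨ cut-∈ σ S (restr-∈ μ-inj S b∈S) ⟩
    restr σ S (restr μ S b)   ≡⟨ restr-∘-cut σ μ S b∈S ⟩
    restr (σ ∘ cut μ S) S b   ≡⟨ cut-∈ (σ ∘ cut μ S) S b∈S ⟨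
    cut (σ ∘ cut μ S) S b     ∎

lemma1 : (n : ℕ) (σ μ : Permutation′ n) (B' : Subset n) →
    ((b : Fin n) →
      cut (σ ⟨$⟩ʳ_) B' (cut (μ ⟨$⟩ʳ_) B' b)
        ≡ cut ((σ ⟨$⟩ʳ_) ∘ cut (μ ⟨$⟩ʳ_) B') B' b)
    × ((b : Fin n) → b ∈ B' →
      restr (σ ⟨$⟩ʳ_) B' (restr (μ ⟨$⟩ʳ_) B' b)
        ≡ restr ((σ ⟨$⟩ʳ_) ∘ cut (μ ⟨$⟩ʳ_) B') B' b)
lemma1 n σ μ B' =
    cut-∘-cut (σ ⟨$⟩ʳ_) (Injection.injective (↔⇒↣ μ)) B'
  , λ b → restr-∘-cut (σ ⟨$⟩ʳ_) (μ ⟨$⟩ʳ_) B'
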